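{- Let $k\geq 1$ and let $\pi^{\varepsilon}$ be a maximal clean compact element of $\hat B_k^{(rd)}$. Let $\alpha_{(1)},\dots,\alpha_{(N)}$ be any clean compact peg permutations, each of length $2k+1$ and with $rd(\alpha_{(j)})=k$, such that $\hat B_k^{(rd)}=\bigcup_{j=1}^N \mathrm{Grid}_{peg}(\alpha_{(j)})$. Then $\pi^\varepsilon=\alpha_{(j)}$ for some $j$.
   Context: A peg permutation of length $n$ is a word $\pi_1^{\varepsilon_1}\cdots\pi_n^{\varepsilon_n}$ where $\pi_1\cdots\pi_n$ is a permutation of $\{1,\dots,n\}$ in one-line notation and each $\varepsilon_i\in\{+,-,\bullet\}$. An increasing (resp. decreasing) strip is a maximal factor of consecutive positions in which each value is one more (resp. one less) than the previous and all entries are decorated $+$ or $\bullet$ (resp. $-$ or $\bullet$); it is clean compact if all strips have length $1$. An identity peg permutation has identity underlying permutation and decorations in $\{+,\bullet\}$. A reversal of a peg permutation reverses a factor and swaps $+\leftrightarrow-$ on the reversed entries ($\bullet$ unchanged); $rd(\pi^\varepsilon)$ is the minimum number of reversals turning it into an identity peg permutation, and $\hat B_k^{(rd)}$ is the set of all peg permutations with $rd\le k$. Peg pattern order: $\sigma^\delta$ of length $m$ is a pattern of $\tau^\varepsilon$ of length $n$ if there are $i_1<\dots<i_m$ with $\tau_{i_1}\cdots\tau_{i_m}$ order-isomorphic to $\sigma$ and, for each $j$, $\delta_j\in\{+,-\}$ implies $\varepsilon_{i_j}=\delta_j$ (e.g. $1^+2^\bullet3^+$ is a pattern of $1^+2^-3^+$).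 A maximal clean compact element of a set $X$ of peg permutations is a clean compact element of $X$ that is not a proper pattern of any other clean compact element of $X$. For a peg permutation $\pi^\varepsilon$ of length $n$ and a vector $v$ of nonnegative integers with $v_i\in\{0,1\}$ whenever $\varepsilon_i=\bullet$, a peg monotone inflation is obtained by replacing each $+$ entry by an increasing run of $v_i$ consecutive values each decorated $+$ or $\bullet$, each $-$ entry by a decreasing run of $v_i$ consecutive values each decorated $-$ or $\bullet$, each $\bullet$ entry by nothing ($v_i=0$) or itself ($v_i=1$), with values arranged so that block $i$ lies entirely below block $j$ whenever $\pi_i<\pi_j$. $\mathrm{Grid}_{peg}(\pi^\varepsilon)$ is the set of all such peg monotone inflations. -}

module Defs where

open import Data.Nat using (ℕ; zero; suc; _+_; _*_; _<_; _≤_)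
open import Data.List using (List; []; _∷_; _++_; map; length; upTo; reverse; concat; zip; lookup)
open import Data.List.Relation.Unary.All using (All)
open import Data.List.Relation.Unary.Any using (Any)
open import Data.List.Relation.Binary.Permutation.Propositional using (_↭_)
open import Data.List.Relation.Binary.Sublist.Propositional using (_⊆_)
open import Data.Fin using (Fin)
open import Data.Product using (Σ; ∃; _×_; _,_; proj₁; proj₂)
open import Data.Sum using (_⊎_)
open import Data.Unit using (⊤)
open import Relation.Nullary using (¬_)
open import Relation.Binary.PropositionalEquality using (_≡_; _≢_)
open import Function.Bundles using (_⇔_)

data Sign : Set where
  plus minus dot : Sign

flipS : Sign → Sign
flipS plus  = minus
flipS minus = plus
flipS dot   = dot

Entry : Set
Entry = ℕ × Sign

val : Entry → ℕ
val = proj₁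

dec : Entry → Sign
dec = proj₂

Word : Set
Word = List Entry

range : ℕ → List ℕ
range n = map suc (upTo n)

IsPeg : Word → Set
IsPeg w = map val w ↭ range (length w)

IsIdentityPeg : Word → Set
IsIdentityPeg w = (map val w ≡ range (length w)) × All (λ e → dec e ≢ minus) w

flipE : Entry → Entry
flipE (x , s) = x , flipS s

Reversal : Word → Word → Set
Reversal w w' = Σ Word λ a → Σ Word λ b → Σ Word λ c →
  (w ≡ a ++ b ++ c) × (w' ≡ a ++ reverse (map flipE b) ++ c)

data Steps : ℕ → Word → Word → Set where
  done : ∀ {w} → Steps zero w w
  step : ∀ {n w w' w''} → Reversal w w' → Steps n w' w'' → Steps (suc n) w w''

RdLe : ℕ → Word → Set
RdLe k w = Σ ℕ λ j → (j ≤ k) × Σ Word λ w' → Steps j w w' × IsIdentityPeg w'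

RdEq : ℕ → Word → Set
RdEq k w = RdLe k w × (∀ j → j < k → ¬ RdLe j w)

InB : ℕ → Word → Set
InB k w = IsPeg w × RdLe k w

IncPair : Entry → Entry → Set
IncPair x y = (val y ≡ suc (val x)) × (dec x ≢ minus) × (dec y ≢ minus)

DecPair : Entry → Entry → Set
DecPair x y = (val x ≡ suc (val y)) × (dec x ≢ plus) × (dec y ≢ plus)

-- all strips have length 1: no two adjacent entries lie in a common strip
CleanCompact : Word → Set
CleanCompact w = ∀ a x y b → w ≡ a ++ x ∷ y ∷ b → ¬ IncPair x y × ¬ DecPair x y

DecCompat : Sign → Sign → Set
DecCompat plus  e = e ≡ plus
DecCompat minus e = e ≡ minus
DecCompat dot   e = ⊤

Matches : Word → Word → Set
Matches σ s =
  (length σ ≡ length s) ×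
  (∀ (i j : Fin (length (zip σ s))) →
     (val (proj₁ (lookup (zip σ s) i)) < val (proj₁ (lookup (zip σ s) j)))
     ⇔ (val (proj₂ (lookup (zip σ s) i)) < val (proj₂ (lookup (zip σ s) j)))) ×
  All (λ p → DecCompat (dec (proj₁ p)) (dec (proj₂ p))) (zip σ s)

PatternOf : Word → Word → Set
PatternOf σ τ = Σ Word λ s → (s ⊆ τ) × Matches σ s

MaxCleanCompact : (Word → Set) → Word → Set
MaxCleanCompact X π =
  X π × CleanCompact π ×
  (∀ τ → X τ → CleanCompact τ → PatternOf π τ → π ≡ τ)

data Consec↑ : Word → Set where
  []  : Consec↑ []
  [_] : ∀ x → Consec↑ (x ∷ [])
  _∷_ : ∀ {x y r} → val y ≡ suc (val x) → Consec↑ (y ∷ r) → Consec↑ (x ∷ y ∷ r)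

data Consec↓ : Word → Set where
  []  : Consec↓ []
  [_] : ∀ x → Consec↓ (x ∷ [])
  _∷_ : ∀ {x y r} → val x ≡ suc (val y) → Consec↓ (y ∷ r) → Consec↓ (x ∷ y ∷ r)

BlockOK : Entry → Word → Set
BlockOK (_ , plus)  b = Consec↑ b × All (λ e → dec e ≢ minus) b
BlockOK (_ , minus) b = Consec↓ b × All (λ e → dec e ≢ plus) b
BlockOK (_ , dot)   b = (b ≡ []) ⊎ (Σ ℕ λ x → b ≡ (x , dot) ∷ [])

InGrid : Word → Word → Set
InGrid α w = IsPeg w × Σ (List Word) λ blocks →
  (length blocks ≡ length α) ×
  (w ≡ concat blocks) ×
  All (λ p → BlockOK (proj₁ p) (proj₂ p)) (zip α blocks) ×
  (∀ (i j : Fin (length (zip α blocks))) →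
     val (proj₁ (lookup (zip α blocks) i)) < val (proj₁ (lookup (zip α blocks) j)) →
     All (λ x → All (λ y → val x < val y) (proj₂ (lookup (zip α blocks) j)))
         (proj₂ (lookup (zip α blocks) i)))

-- Every entry of a monotone inflation comes from a block, and a block of two or
-- more entries is itself a strip.  So a clean compact inflation of α keeps at
-- most one entry per block, with a compatible decoration, and since the blocks
-- of α are ordered like the entries of α this exhibits π as a pattern of α.
-- As π lies in B̂ₖ, it is an inflation of some α₍ⱼ₎, which is a clean compact
-- element of B̂ₖ; maximality of π forces π = α₍ⱼ₎.
module Submission where

open import Defs
open import Data.Nat using (ℕ; _≤_; _+_; _*_)
open import Data.List using (List; length)
open import Data.List.Relation.Unary.All using (All)
open import Data.List.Relation.Unary.Any using (Any)
open import Data.List.Membership.Propositional using (_∈_)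
open import Data.Product using (_×_)
open import Relation.Binary.PropositionalEquality using (_≡_)
open import Function.Bundles using (_⇔_)

open import Level using (Level)
open import Data.Nat using (suc; _<_)
open import Data.Nat.Properties using (<-cmp; <-irrefl; <-asym; suc-injective)
open import Data.Fin using (Fin)
open import Data.List using ([]; _∷_; _++_; map; zip; concat; lookup)
open import Data.List.Properties using (length-map; map-∘)
open import Data.List.Relation.Unary.All using ([]; _∷_)
import Data.List.Relation.Unary.All as All
open import Data.List.Relation.Unary.Any using (here; there; index)
open import Data.List.Relation.Unary.Any.Properties using (lookup-index)
open import Data.List.Relation.Unary.AllPairs using (AllPairs; []; _∷_)
open import Data.List.Relation.Unary.Unique.Propositional using (Unique)
open import Data.List.Relation.Unary.Unique.Propositional.Properties using (upTo⁺)
import Data.List.Relation.Unary.Unique.Propositional.Properties as Unique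
open import Data.List.Membership.Propositional using (find)
open import Data.List.Membership.Propositional.Properties using (∈-lookup; ∈-map⁺)
open import Data.List.Relation.Binary.Permutation.Propositional using (↭-sym; ↭⇒↭ₛ)
open import Data.List.Relation.Binary.Permutation.Setoid.Properties using (Unique-resp-↭)
open import Data.List.Relation.Binary.Sublist.Propositional using (_⊆_; _⊇_; []; _∷ʳ_; _∷_)
open import Data.List.Relation.Binary.Sublist.Propositional.Properties using (All-resp-⊆)
import Data.List.Relation.Binary.Sublist.Propositional.Properties as Sublist
open import Data.Product using (_,_; proj₁; proj₂)
open import Data.Sum using (_⊎_; inj₁; inj₂)
open import Data.Unit using (tt)
open import Data.Empty using (⊥-elim)
open import Relation.Binary.Core using (Rel)
open import Relation.Binary.Definitions using (_Respects_; tri<; tri≈; tri>)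
open import Relation.Binary.PropositionalEquality
  using (refl; sym; trans; cong; subst; subst₂; setoid)
open import Function.Base using (_∘_)
open import Function.Bundles using (mk⇔; Equivalence)

private
  variable
    ℓ : Level
    A B : Set

AllPairs-resp-⊇ : {R : Rel A ℓ} → AllPairs R Respects _⊇_
AllPairs-resp-⊇ []         []       = []
AllPairs-resp-⊇ (_ ∷ʳ s)   (_ ∷ rs) = AllPairs-resp-⊇ s rs
AllPairs-resp-⊇ (refl ∷ s) (r ∷ rs) = All-resp-⊆ s r ∷ AllPairs-resp-⊇ s rs

Unique-map⇒injective-on-∈ : (f : A → B) {xs : List A} {x y : A} →
  Unique (map f xs) → x ∈ xs → y ∈ xs → f x ≡ f y → x ≡ y
Unique-map⇒injective-on-∈ f _          (here refl) (here refl) _   = refl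
Unique-map⇒injective-on-∈ f (x∉ ∷ _)   (here refl) (there y∈)  fx≡fy = ⊥-elim (All.lookup x∉ (∈-map⁺ f y∈) fx≡fy)
Unique-map⇒injective-on-∈ f (y∉ ∷ _)   (there x∈)  (here refl) fx≡fy = ⊥-elim (All.lookup y∉ (∈-map⁺ f x∈) (sym fx≡fy))
Unique-map⇒injective-on-∈ f (_ ∷ uniq) (there x∈)  (there y∈)  fx≡fy = Unique-map⇒injective-on-∈ f uniq x∈ y∈ fx≡fy

module _ (P : A → A → Set) {xs : List A} where

  ∀-lookup⇒∀-∈ : (∀ i j → P (lookup xs i) (lookup xs j)) →
    ∀ {x y} → x ∈ xs → y ∈ xs → P x y
  ∀-lookup⇒∀-∈ h x∈ y∈ =
    subst₂ P (sym (lookup-index x∈)) (sym (lookup-index y∈)) (h (index x∈) (index y∈))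

  ∀-∈⇒∀-lookup : (∀ {x y} → x ∈ xs → y ∈ xs → P x y) →
    ∀ i j → P (lookup xs i) (lookup xs j)
  ∀-∈⇒∀-lookup h i j = h (∈-lookup i) (∈-lookup j)

zip-map-proj₁-proj₂ : (ps : List (A × B)) → zip (map proj₁ ps) (map proj₂ ps) ≡ ps
zip-map-proj₁-proj₂ []       = refl
zip-map-proj₁-proj₂ (p ∷ ps) = cong (p ∷_) (zip-map-proj₁-proj₂ ps)

IsPeg⇒Unique : ∀ {w} → IsPeg w → Unique (map val w)
IsPeg⇒Unique {w} peg =
  Unique-resp-↭ (setoid ℕ) (↭⇒↭ₛ (↭-sym peg)) (Unique.map⁺ suc-injective (upTo⁺ (length w)))

CleanCompact-∷⁻ : ∀ {x w} → CleanCompact (x ∷ w) → CleanCompact w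
CleanCompact-∷⁻ {x} cc a y z b w≡ = cc (x ∷ a) y z b (cong (x ∷_) w≡)

BlockOK-∷∷⇒strip : ∀ e x y r → BlockOK e (x ∷ y ∷ r) → IncPair x y ⊎ DecPair x y
BlockOK-∷∷⇒strip (_ , plus)  x y r ((y≡ ∷ _) , (x≢ ∷ y≢ ∷ _)) = inj₁ (y≡ , x≢ , y≢)
BlockOK-∷∷⇒strip (_ , minus) x y r ((x≡ ∷ _) , (x≢ ∷ y≢ ∷ _)) = inj₂ (x≡ , x≢ , y≢)
BlockOK-∷∷⇒strip (_ , dot)   x y r (inj₁ ())
BlockOK-∷∷⇒strip (_ , dot)   x y r (inj₂ (_ , ()))

BlockOK-[x]⇒DecCompat : ∀ e x → BlockOK e (x ∷ []) → DecCompat (dec x) (dec e)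
BlockOK-[x]⇒DecCompat (_ , plus)  (_ , plus)  _                = refl
BlockOK-[x]⇒DecCompat (_ , plus)  (_ , minus) (_ , (x≢ ∷ []))  = ⊥-elim (x≢ refl)
BlockOK-[x]⇒DecCompat (_ , plus)  (_ , dot)   _                = tt
BlockOK-[x]⇒DecCompat (_ , minus) (_ , plus)  (_ , (x≢ ∷ []))  = ⊥-elim (x≢ refl)
BlockOK-[x]⇒DecCompat (_ , minus) (_ , minus) _                = refl
BlockOK-[x]⇒DecCompat (_ , minus) (_ , dot)   _                = tt
BlockOK-[x]⇒DecCompat (_ , dot)   _           (inj₁ ())
BlockOK-[x]⇒DecCompat (_ , dot)   _           (inj₂ (_ , refl)) = tt

-- A pair (x , a) records that the entry x of the inflation is the whole block
-- replacing the entry a of α.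
record SingletonBlocks (α : Word) (blocks : List Word) : Set where
  field
    pairs           : List (Entry × Entry)
    concat-blocks   : concat blocks ≡ map proj₁ pairs
    sources⊆α       : map proj₂ pairs ⊆ α
    compatible      : All (λ p → DecCompat (dec (proj₁ p)) (dec (proj₂ p))) pairs
    singleton-block : ∀ {p} → p ∈ pairs → (proj₂ p , proj₁ p ∷ []) ∈ zip α blocks

cleanCompact⇒singletonBlocks : (α : Word) (blocks : List Word) →
  length blocks ≡ length α →
  All (λ p → BlockOK (proj₁ p) (proj₂ p)) (zip α blocks) →
  CleanCompact (concat blocks) → SingletonBlocks α blocks
cleanCompact⇒singletonBlocks []      []       _ _ _ =
  record { pairs = [] ; concat-blocks = refl ; sources⊆α = [] ; compatible = []
         ; singleton-block = λ () }
cleanCompact⇒singletonBlocks (a ∷ α) ([] ∷ bs) len≡ (_ ∷ oks) cc =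
  record { pairs = pairs ; concat-blocks = concat-blocks ; sources⊆α = a ∷ʳ sources⊆α
         ; compatible = compatible ; singleton-block = λ p∈ → there (singleton-block p∈) }
  where open SingletonBlocks (cleanCompact⇒singletonBlocks α bs (suc-injective len≡) oks cc)
cleanCompact⇒singletonBlocks (a ∷ α) ((x ∷ []) ∷ bs) len≡ (ok ∷ oks) cc =
  record { pairs = (x , a) ∷ pairs ; concat-blocks = cong (x ∷_) concat-blocks
         ; sources⊆α = refl ∷ sources⊆α
         ; compatible = BlockOK-[x]⇒DecCompat a x ok ∷ compatible
         ; singleton-block = λ { (here refl) → here refl ; (there p∈) → there (singleton-block p∈) } }
  where
    open SingletonBlocks
      (cleanCompact⇒singletonBlocks α bs (suc-injective len≡) oks (CleanCompact-∷⁻ cc))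
cleanCompact⇒singletonBlocks (a ∷ α) ((x ∷ y ∷ r) ∷ bs) _ (ok ∷ _) cc
  with BlockOK-∷∷⇒strip a x y r ok
... | inj₁ inc = ⊥-elim (proj₁ (cc [] x y (r ++ concat bs) refl) inc)
... | inj₂ dec = ⊥-elim (proj₂ (cc [] x y (r ++ concat bs) refl) dec)

cleanCompactInflation⇒pattern : ∀ {π α} → IsPeg α → CleanCompact π → InGrid α π →
  PatternOf π α
cleanCompactInflation⇒pattern {π} {α} pegα ccπ (_ , blocks , len≡ , π≡ , oks , ordered) =
  map proj₂ pairs , sources⊆α , subst (λ σ → Matches σ (map proj₂ pairs)) (sym π≡pairs) matches
  where
    open SingletonBlocks
      (cleanCompact⇒singletonBlocks α blocks len≡ oks (subst CleanCompact π≡ ccπ))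

    π≡pairs : π ≡ map proj₁ pairs
    π≡pairs = trans π≡ concat-blocks

    BlocksBelow : Entry × Word → Entry × Word → Set
    BlocksBelow u v = val (proj₁ u) < val (proj₁ v) →
      All (λ x → All (λ y → val x < val y) (proj₂ v)) (proj₂ u)

    source-order : ∀ {p q} → p ∈ pairs → q ∈ pairs →
      val (proj₂ p) < val (proj₂ q) → val (proj₁ p) < val (proj₁ q)
    source-order p∈ q∈ lt
      with ∀-lookup⇒∀-∈ BlocksBelow ordered (singleton-block p∈) (singleton-block q∈) lt
    ... | (below ∷ []) ∷ [] = below

    source-unique : Unique (map (val ∘ proj₂) pairs)
    source-unique = subst Unique (sym (map-∘ pairs))
      (AllPairs-resp-⊇ (Sublist.map⁺ val sources⊆α) (IsPeg⇒Unique pegα))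

    SameOrder : Entry × Entry → Entry × Entry → Set
    SameOrder p q = (val (proj₁ p) < val (proj₁ q)) ⇔ (val (proj₂ p) < val (proj₂ q))

    order-iso : ∀ {p q} → p ∈ pairs → q ∈ pairs → SameOrder p q
    order-iso {p} {q} p∈ q∈ = mk⇔ to (source-order p∈ q∈)
      where
        to : val (proj₁ p) < val (proj₁ q) → val (proj₂ p) < val (proj₂ q)
        to lt with <-cmp (val (proj₂ p)) (val (proj₂ q))
        ... | tri< p<q _ _ = p<q
        ... | tri> _ _ q<p = ⊥-elim (<-asym lt (source-order q∈ p∈ q<p))
        ... | tri≈ _ p≡q _
          with refl ← Unique-map⇒injective-on-∈ (val ∘ proj₂) source-unique p∈ q∈ p≡q
          = ⊥-elim (<-irrefl refl lt)

    matches : Matches (map proj₁ pairs) (map proj₂ pairs)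
    matches =
      trans (length-map proj₁ pairs) (sym (length-map proj₂ pairs)) ,
      subst (λ zs → ∀ (i j : Fin (length zs)) → SameOrder (lookup zs i) (lookup zs j))
        (sym (zip-map-proj₁-proj₂ pairs)) (∀-∈⇒∀-lookup SameOrder order-iso) ,
      subst (All _) (sym (zip-map-proj₁-proj₂ pairs)) compatible

mainTheorem2 : (k : ℕ) → 1 ≤ k → (π : Word) → MaxCleanCompact (InB k) π →
    (αs : List Word) →
    All (λ α → IsPeg α × CleanCompact α × (length α ≡ 2 * k + 1) × RdEq k α) αs →
    (∀ w → InB k w ⇔ Any (λ α → InGrid α w) αs) →
    π ∈ αs
mainTheorem2 k _ π (π∈B , ccπ , maximal) αs props cover =
  let α , α∈αs , π∈Grid = find (Equivalence.to (cover π) π∈B)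
      pegα , ccα , _ , rd≤k , _ = All.lookup props α∈αs
  in subst (_∈ αs) (sym (maximal α (pegα , rd≤k) ccα (cleanCompactInflation⇒pattern pegα ccπ π∈Grid))) α∈αs
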